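{- For every finite simple graph $G$, $\beta_{odd}(G)\leq\Gamma_{odd}(G)$ and $\gamma_{odd}(G)\leq i_{odd}(G)$.
   Context: For $S\subseteq V$, $\langle S\rangle$ is the induced subgraph; maximal/minimal are with respect to inclusion. $S$ is odd-cycle independent if $\langle S\rangle$ contains no odd cycle; $\beta_{odd}(G)$ is the maximum size of an odd-cycle independent set and $i_{odd}(G)$ the minimum size of a maximal one. $S$ is odd-cycle dominating if for every $v\in V\setminus S$ there is $u\in S$ such that $u$ and $v$ lie on a common odd cycle of $\langle S\cup\{v\}\rangle$; $\Gamma_{odd}(G)$ is the maximum and $\gamma_{odd}(G)$ the minimum size of a minimal odd-cycle dominating set. -}

module Defs where

open import Data.Nat using (ℕ; zero; suc; _*_; _≤_)
open import Data.Fin using (Fin; zero; suc; inject₁; fromℕ)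
open import Data.Fin.Subset using (Subset; _∈_; _∉_; _⊂_; _∪_; ⁅_⁆; ∣_∣)
open import Data.Product using (Σ; ∃; _×_)
open import Relation.Binary.PropositionalEquality using (_≡_)
open import Relation.Nullary using (¬_)
open import Function.Definitions using (Injective)

record SimpleGraph (n : ℕ) : Set₁ where
  field
    _~_    : Fin n → Fin n → Set
    sym    : ∀ {x y} → x ~ y → y ~ x
    irrefl : ∀ {x} → ¬ (x ~ x)

module _ {n : ℕ} (G : SimpleGraph n) where
  open SimpleGraph G

  -- An odd cycle of the induced subgraph ⟨S⟩: a cyclic sequence
  -- c 0, c 1, ..., c m (length k = m + 1) of pairwise distinct vertices
  -- of S, consecutive ones adjacent and c m adjacent to c 0, with
  -- k odd and k ≥ 3.
  record OddCycleIn (S : Subset n) : Set where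
    field
      m        : ℕ
      three≤   : 3 ≤ suc m
      odd      : ∃ λ t → suc m ≡ suc (2 * t)
      vertex   : Fin (suc m) → Fin n
      distinct : Injective _≡_ _≡_ vertex
      inS      : ∀ i → vertex i ∈ S
      step     : ∀ (i : Fin m) → vertex (inject₁ i) ~ vertex (suc i)
      close    : vertex (fromℕ m) ~ vertex zero

  OnCycle : ∀ {S} → Fin n → OddCycleIn S → Set
  OnCycle x C = ∃ λ i → OddCycleIn.vertex C i ≡ x

  OddCycleIndependent : Subset n → Set
  OddCycleIndependent S = ¬ OddCycleIn S

  OddCycleDominating : Subset n → Set
  OddCycleDominating S =
    ∀ v → v ∉ S → ∃ λ u → u ∈ S ×
      (Σ (OddCycleIn (S ∪ ⁅ v ⁆)) λ C → OnCycle u C × OnCycle v C)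

  MaximalOCI : Subset n → Set
  MaximalOCI S = OddCycleIndependent S × (∀ T → S ⊂ T → ¬ OddCycleIndependent T)

  MinimalOCD : Subset n → Set
  MinimalOCD S = OddCycleDominating S × (∀ T → T ⊂ S → ¬ OddCycleDominating T)

IsMaxSize : ∀ {n} → (Subset n → Set) → ℕ → Set
IsMaxSize P k = (∃ λ S → P S × ∣ S ∣ ≡ k) × (∀ S → P S → ∣ S ∣ ≤ k)

IsMinSize : ∀ {n} → (Subset n → Set) → ℕ → Set
IsMinSize P k = (∃ λ S → P S × ∣ S ∣ ≡ k) × (∀ S → P S → k ≤ ∣ S ∣)

module _ {n : ℕ} (G : SimpleGraph n) where
  IsBetaOdd : ℕ → Set
  IsBetaOdd = IsMaxSize (OddCycleIndependent G)

  IsIOdd : ℕ → Set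
  IsIOdd = IsMinSize (MaximalOCI G)

  IsUpperGammaOdd : ℕ → Set
  IsUpperGammaOdd = IsMaxSize (MinimalOCD G)

  IsGammaOdd : ℕ → Set
  IsGammaOdd = IsMinSize (MinimalOCD G)

-- Every maximal odd-cycle independent set S is a minimal odd-cycle dominating
-- set. Domination: for v ∉ S, maximality puts an odd cycle in ⟨S ∪ {v}⟩; it
-- must pass through v (⟨S⟩ has none) and through some other vertex, which
-- lies in S. Minimality: were T ⊂ S dominating, any x ∈ S ∖ T would lie on
-- an odd cycle of ⟨T ∪ {x}⟩ ⊆ ⟨S⟩. Both inequalities follow by applying this
-- to a maximum independent set (which is maximal) and to a minimum maximal one.
--
-- Adjacency is not decidable, so maximality only yields that cycle up to
-- double negation; this suffices because inequalities of naturals are stable.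
module Submission where

open import Defs
open import Data.Nat using (ℕ; _≤_; zero; suc; s≤s)
open import Data.Nat.Properties using (_≤?_; <⇒≱)
open import Data.Product using (_×_; _,_; ∃)
open import Data.Sum using (inj₁; inj₂)
open import Data.Fin using (Fin; zero; fromℕ)
open import Data.Fin.Properties using (any?; sequence) renaming (_≟_ to _≟ᶠ_)
open import Data.Fin.Subset using (Subset; _∈_; _∉_; _⊂_; _⊆_; _∪_; ⁅_⁆; ∣_∣)
open import Data.Fin.Subset.Properties
  using (_∈?_; p⊂q⇒∣p∣<∣q∣; x∈p∪q⁻; x∈⁅y⁆⇒x≡y; x∈⁅x⁆; p⊆p∪q; q⊆p∪q)
open import Effect.Monad using (RawMonad)
open import Relation.Nullary using (¬_; yes; no; contradiction)
open import Relation.Nullary.Decidable using (decidable-stable)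
open import Relation.Nullary.Negation using (¬¬-map; ¬¬-Monad)
open import Relation.Binary.PropositionalEquality using (_≡_; _≢_; refl; trans; sym)

∈-∪⁅⁆⁻ : ∀ {n} {S : Subset n} {v x} → x ∈ S ∪ ⁅ v ⁆ → x ≢ v → x ∈ S
∈-∪⁅⁆⁻ {S = S} {v} x∈ x≢v with x∈p∪q⁻ S ⁅ v ⁆ x∈
... | inj₁ x∈S = x∈S
... | inj₂ x∈⁅v⁆ = contradiction (x∈⁅y⁆⇒x≡y v x∈⁅v⁆) x≢v

∪⁅⁆-⊆ : ∀ {n} {T S : Subset n} {x} → T ⊆ S → x ∈ S → T ∪ ⁅ x ⁆ ⊆ S
∪⁅⁆-⊆ {T = T} {x = x} T⊆S x∈S y∈ with x∈p∪q⁻ T ⁅ x ⁆ y∈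
... | inj₁ y∈T = T⊆S y∈T
... | inj₂ y∈⁅x⁆ rewrite x∈⁅y⁆⇒x≡y x y∈⁅x⁆ = x∈S

⊂-∪⁅⁆ : ∀ {n} {S : Subset n} {v} → v ∉ S → S ⊂ S ∪ ⁅ v ⁆
⊂-∪⁅⁆ {S = S} {v} v∉S = p⊆p∪q ⁅ v ⁆ , v , q⊆p∪q S ⁅ v ⁆ (x∈⁅x⁆ v) , v∉S

maxSize⇒maximal : ∀ {n} {P : Subset n → Set} {S : Subset n} →
  (∀ T → P T → ∣ T ∣ ≤ ∣ S ∣) → ∀ T → S ⊂ T → ¬ P T
maxSize⇒maximal bound T S⊂T PT = <⇒≱ (p⊂q⇒∣p∣<∣q∣ S⊂T) (bound T PT)

module _ {n : ℕ} (G : SimpleGraph n) where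

  Dominates : Subset n → Fin n → Set
  Dominates S v = ∃ λ u → u ∈ S ×
    ∃ λ (C : OddCycleIn G (S ∪ ⁅ v ⁆)) → OnCycle G u C × OnCycle G v C

  module _ {T : Subset n} (C : OddCycleIn G T) where
    open OddCycleIn C

    restrict : ∀ {S} → (∀ i → vertex i ∈ S) → OddCycleIn G S
    restrict ∈S = record
      { m = m ; three≤ = three≤ ; odd = odd ; vertex = vertex
      ; distinct = distinct ; inS = ∈S ; step = step ; close = close }

    -- The first and last vertices differ because a cycle has length ≥ 3.
    ∃-vertex-≢ : ∀ v → ∃ λ i → vertex i ≢ v
    ∃-vertex-≢ v with vertex zero ≟ᶠ v
    ... | no first≢v = zero , first≢v
    ... | yes first≡v = fromℕ m , λ last≡v → last≢zero m three≤ (distinct (trans last≡v (sym first≡v)))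
      where
        last≢zero : ∀ k → 3 ≤ suc k → fromℕ k ≢ zero
        last≢zero zero (s≤s ()) _
        last≢zero (suc k) _ ()

  OddCycleIn-mono : ∀ {S T} → S ⊆ T → OddCycleIn G S → OddCycleIn G T
  OddCycleIn-mono S⊆T C = restrict C (λ i → S⊆T (OddCycleIn.inS C i))

  independent⇒dominates : ∀ {S v} → OddCycleIndependent G S →
    OddCycleIn G (S ∪ ⁅ v ⁆) → Dominates S v
  independent⇒dominates {v = v} ind C with ∃-vertex-≢ C v
  ... | u , u≢v = vertex u , ∈-∪⁅⁆⁻ (inS u) u≢v , C , (u , refl) , v∈C
    where
      open OddCycleIn C
      v∈C : OnCycle G v C
      v∈C = decidable-stable (any? λ i → vertex i ≟ᶠ v) λ v∉C →
        ind (restrict C λ i → ∈-∪⁅⁆⁻ (inS i) λ i≡v → v∉C (i , i≡v))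

  independent⇒¬dominating-⊂ : ∀ {S T} → OddCycleIndependent G S →
    T ⊂ S → ¬ OddCycleDominating G T
  independent⇒¬dominating-⊂ ind (T⊆S , x , x∈S , x∉T) dom
    with dom x x∉T
  ... | _ , _ , C , _ = ind (OddCycleIn-mono (∪⁅⁆-⊆ T⊆S x∈S) C)

  maximalOCI⇒¬¬dominating : ∀ {S} → MaximalOCI G S → ¬ ¬ OddCycleDominating G S
  maximalOCI⇒¬¬dominating {S} (ind , maximal) =
    sequence (RawMonad.rawApplicative ¬¬-Monad) dominatesOutside
    where
      dominatesOutside : ∀ v → ¬ ¬ (v ∉ S → Dominates S v)
      dominatesOutside v with v ∈? S
      ... | yes v∈S = λ ¬dom → ¬dom (contradiction v∈S)
      ... | no v∉S = ¬¬-map (λ C _ → independent⇒dominates ind C)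
                            (maximal (S ∪ ⁅ v ⁆) (⊂-∪⁅⁆ v∉S))

  maximalOCI⇒¬¬minimalOCD : ∀ {S} → MaximalOCI G S → ¬ ¬ MinimalOCD G S
  maximalOCI⇒¬¬minimalOCD mx@(ind , _) =
    ¬¬-map (λ dom → dom , λ T T⊂S → independent⇒¬dominating-⊂ ind T⊂S)
           (maximalOCI⇒¬¬dominating mx)

mainTheorem15 : ∀ {n} (G : SimpleGraph n) (β Γ γ i : ℕ) →
    IsBetaOdd G β → IsUpperGammaOdd G Γ → IsGammaOdd G γ → IsIOdd G i →
    β ≤ Γ × γ ≤ i
mainTheorem15 G β Γ γ i ((S , indS , refl) , maxβ) (_ , boundΓ) (_ , boundγ) ((I , maxI , refl) , _) =
  decidable-stable (β ≤? Γ) (¬¬-map (boundΓ S) (maximalOCI⇒¬¬minimalOCD G maxS)) ,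
  decidable-stable (γ ≤? i) (¬¬-map (boundγ I) (maximalOCI⇒¬¬minimalOCD G maxI))
  where
    maxS : MaximalOCI G S
    maxS = indS , maxSize⇒maximal maxβ
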